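{- Let $c>b>a\ge 2$ be pairwise coprime integers, let $k=\lfloor c/b\rfloor$, let $\ell\in\{0,1,\ldots,a-1\}$ with $\ell\equiv cb^{ -1}\pmod a$, and let $q=\lfloor a/(a-\ell)\rfloor$, $r=a-q(a-\ell)$. For non-negative integers $x,y$ put $\mathbf{v}(x,y)=bx+cy$. Suppose $\ell>k$ and $br>cq$, and let $\mathbf{v}(x,y)$ and $\mathbf{v}(x',y')$ be consecutive local minima (with $y<y'$). Then either $$y'-y=\begin{cases}q+1 & \text{if } 0\le x<r,\\ q & \text{if } r\le x<a-\ell,\end{cases}\qquad\text{and}\qquad x'-x=\begin{cases}a-\ell-r & \text{if } 0\le x<r,\\ -r & \text{if } r\le x<a-\ell,\end{cases}$$ or $$y'-y>\begin{cases}q+1 & \text{if } 0\le x<r,\\ q & \text{if } r\le x<a-\ell,\end{cases}$$ and in this latter case $q=1$ and $r=\ell$.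
   Context: Reductions modulo $n$ are taken in $\{0,1,\ldots,n-1\}$. For $x\in\{0,\ldots,a-1\}$ and $y\in\{0,\ldots,a-1\}$, $\mathbf{v}(x,y)$ is called a local minimum if $\mathbf{v}(x,y)\le\mathbf{v}((x-\ell)\bmod a,\,y+1)$ whenever $y\le a-2$, and $\mathbf{v}(x,y)\le\mathbf{v}((x+\ell)\bmod a,\,y-1)$ whenever $y\ge1$. The values are considered along sequences $t\mapsto \mathbf{v}((x_0+t(a-\ell))\bmod a,\,t)$. Two local minima $\mathbf{v}(x,y)$ and $\mathbf{v}(x',y')$ on the same such sequence, with $y<y'$, are consecutive if there is no local minimum $\mathbf{v}(\tilde x,\tilde y)$ on that sequence with $y<\tilde y<y'$. -}

module Defs where

open import Data.Nat using (ℕ; zero; suc; _+_; _*_; _∸_; _≤_; _<_; NonZero)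
open import Data.Nat.DivMod using (_%_; _/_)
open import Data.Integer using (ℤ; +_; _-_)
open import Data.Integer.DivMod using (_%ℕ_)
open import Data.Product using (_×_; ∃-syntax)
open import Relation.Binary.PropositionalEquality using (_≡_)
open import Relation.Nullary using (¬_)

v : (b c x y : ℕ) → ℕ
v b c x y = b * x + c * y

_mod_ : ℤ → (a : ℕ) → .{{NonZero a}} → ℕ
n mod a = n %ℕ a

IsLocalMin : (a b c ℓ : ℕ) → .{{NonZero a}} → (x y : ℕ) → Set
IsLocalMin a b c ℓ x y =
  x < a × y < a
  × (y ≤ a ∸ 2 → v b c x y ≤ v b c ((+ x - + ℓ) mod a) (suc y))
  × (1 ≤ y → v b c x y ≤ v b c ((+ x Data.Integer.+ + ℓ) mod a) (y ∸ 1))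

OnSeq : (a ℓ : ℕ) → .{{NonZero a}} → (x₀ x y : ℕ) → Set
OnSeq a ℓ x₀ x y = x ≡ (x₀ + y * (a ∸ ℓ)) % a

Consecutive : (a b c ℓ : ℕ) → .{{NonZero a}} → (x y x' y' : ℕ) → Set
Consecutive a b c ℓ x y x' y' =
  ∃[ x₀ ] (x₀ < a
    × OnSeq a ℓ x₀ x y × OnSeq a ℓ x₀ x' y'
    × IsLocalMin a b c ℓ x y × IsLocalMin a b c ℓ x' y'
    × y < y'
    × ¬ (∃[ x̃ ] ∃[ ỹ ] (OnSeq a ℓ x₀ x̃ ỹ × IsLocalMin a b c ℓ x̃ ỹ × y < ỹ × ỹ < y')))

module Submission where

open import Defs
open import Data.Nat
  using (ℕ; suc; _+_; _*_; _∸_; _≤_; _<_; _>_; NonZero; >-nonZero; z<s; _<?_; _≤?_)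
open import Data.Nat.Properties
open import Data.Nat.DivMod hiding (_mod_)
open import Data.Nat.Coprimality using (Coprime)
import Data.Integer as ℤ
import Data.Integer.Properties as ℤ
open import Data.Product using (_×_; _,_; proj₁; proj₂)
open import Data.Sum using (_⊎_; inj₁; inj₂; map)
open import Relation.Nullary using (yes; no; contradiction)
open import Relation.Binary.PropositionalEquality

-- Along a sequence, one step up in y moves x to x + (a − ℓ) mod a.  A local minimum
-- above the bottom row must lie in the strip x < a − ℓ, since otherwise its lower
-- neighbour x + ℓ − a < x is smaller.  Conversely, as c ≤ bℓ, every point of the strip
-- with x < ℓ is a local minimum.  Hence, starting from a local minimum (x, y) in the
-- strip, no local minimum occurs until the sequence first wraps around mod a, at the
-- point x_T = x + J(a − ℓ) − a < a − ℓ; if the next minimum is not there, then x_T ≥ ℓ,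
-- so ℓ < a − ℓ and a = 1·(a − ℓ) + ℓ is the division of a by a − ℓ: q = 1 and r = ℓ.  With a = r + q(a − ℓ)
-- the first wrap happens at J = q + 1, x_T = x + (a − ℓ − r) when x < r, and at
-- J = q, x_T = x − r otherwise.

[m%n+o]%n≡[m+o]%n : ∀ m o n .{{_ : NonZero n}} → (m % n + o) % n ≡ (m + o) % n
[m%n+o]%n≡[m+o]%n m o n = begin
  (m % n + o) % n          ≡⟨ %-distribˡ-+ (m % n) o n ⟩
  (m % n % n + o % n) % n  ≡⟨ cong (λ t → (t + o % n) % n) (m%n%n≡m%n m n) ⟩
  (m % n + o % n) % n      ≡⟨ %-distribˡ-+ m o n ⟨
  (m + o) % n              ∎
  where open ≡-Reasoning

m/n<o⇒m<o*n : ∀ {m n o} .{{_ : NonZero n}} → m / n < o → m < o * n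
m/n<o⇒m<o*n {m} {n} {o} m/n<o = begin-strict
  m                  ≡⟨ m≡m%n+[m/n]*n m n ⟩
  m % n + m / n * n  <⟨ +-monoˡ-< (m / n * n) (m%n<n m n) ⟩
  suc (m / n) * n    ≤⟨ *-monoˡ-≤ n m/n<o ⟩
  o * n              ∎
  where open ≤-Reasoning

[-n]mod-o≡o∸n : ∀ o n .{{_ : NonZero o}} → 0 < n → n < o → (ℤ.- ℤ.+ n) mod o ≡ o ∸ n
[-n]mod-o≡o∸n o (suc d) _ n<o with suc d % o | m<n⇒m%n≡m n<o
... | .(suc d) | refl = refl

m<n⇒[m-n]mod≡o∸[n∸m] : ∀ {m n} o .{{_ : NonZero o}} → m < n → n < o →
                         (ℤ.+ m ℤ.- ℤ.+ n) mod o ≡ o ∸ (n ∸ m)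
m<n⇒[m-n]mod≡o∸[n∸m] {m} {n} o m<n n<o = begin
  (ℤ.+ m ℤ.- ℤ.+ n) mod o  ≡⟨ cong (λ z → z mod o) (trans (ℤ.m-n≡m⊖n m n) (ℤ.⊖-< m<n)) ⟩
  (ℤ.- ℤ.+ (n ∸ m)) mod o  ≡⟨ [-n]mod-o≡o∸n o (n ∸ m) (m<n⇒0<n∸m m<n) (≤-<-trans (m∸n≤m n m) n<o) ⟩
  o ∸ (n ∸ m)              ∎
  where open ≡-Reasoning

v-mono-up : ∀ b c {x x'} y → x ≤ x' → v b c x y ≤ v b c x' (suc y)
v-mono-up b c y x≤x' = +-mono-≤ (*-monoʳ-≤ b x≤x') (*-monoʳ-≤ c (n≤1+n y))

v-mono-down : ∀ b c x ℓ y → c ≤ b * ℓ → v b c x (suc y) ≤ v b c (x + ℓ) y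
v-mono-down b c x ℓ y c≤bℓ = begin
  b * x + c * suc y      ≡⟨ cong (b * x +_) (*-suc c y) ⟩
  b * x + (c + c * y)    ≡⟨ +-assoc (b * x) c (c * y) ⟨
  b * x + c + c * y      ≤⟨ +-monoˡ-≤ (c * y) (+-monoʳ-≤ (b * x) c≤bℓ) ⟩
  b * x + b * ℓ + c * y  ≡⟨ cong (_+ c * y) (*-distribˡ-+ b x ℓ) ⟨
  b * (x + ℓ) + c * y    ∎
  where open ≤-Reasoning

module LocalMinima (a b c ℓ : ℕ) .{{_ : NonZero a}} .{{_ : NonZero b}}
                   .{{_ : NonZero (a ∸ ℓ)}} (ℓ<a : ℓ < a) where

  private
    m q r : ℕ
    m = a ∸ ℓ
    q = a / m
    r = a ∸ q * m

  a≡ℓ+m : a ≡ ℓ + m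
  a≡ℓ+m = sym (m+[n∸m]≡n (<⇒≤ ℓ<a))

  m≤a : m ≤ a
  m≤a = m∸n≤m a ℓ

  r≡a%m : r ≡ a % m
  r≡a%m = sym (m%n≡m∸m/n*n a m)

  a≡r+q*m : a ≡ r + q * m
  a≡r+q*m = trans (m≡m%n+[m/n]*n a m) (cong (_+ q * m) (sym r≡a%m))

  r<m : r < m
  r<m = subst (_< m) (sym r≡a%m) (m%n<n a m)

  q>0 : q > 0
  q>0 = m≥n⇒m/n>0 m≤a

  ℓ<m⇒q≡1×r≡ℓ : ℓ < m → q ≡ 1 × r ≡ ℓ
  ℓ<m⇒q≡1×r≡ℓ ℓ<m = q≡1 , r≡ℓ
    where
    open ≡-Reasoning
    q≡1 : q ≡ 1
    q≡1 = begin
      a / m            ≡⟨ m/n≡1+[m∸n]/n m≤a ⟩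
      1 + (a ∸ m) / m  ≡⟨ cong (λ t → 1 + t / m) (m∸[m∸n]≡n (<⇒≤ ℓ<a)) ⟩
      1 + ℓ / m        ≡⟨ cong (1 +_) (m<n⇒m/n≡0 ℓ<m) ⟩
      1                ∎
    r≡ℓ : r ≡ ℓ
    r≡ℓ = begin
      r            ≡⟨ r≡a%m ⟩
      a % m        ≡⟨ cong (_% m) a≡ℓ+m ⟩
      (ℓ + m) % m  ≡⟨ [m+n]%n≡m%n ℓ m ⟩
      ℓ % m        ≡⟨ m<n⇒m%n≡m ℓ<m ⟩
      ℓ            ∎

  onSeq-shift : ∀ x₀ y {x} → OnSeq a ℓ x₀ x y → ∀ j → OnSeq a ℓ x₀ ((x + j * m) % a) (y + j)
  onSeq-shift x₀ y {x} refl j = begin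
    ((x₀ + y * m) % a + j * m) % a  ≡⟨ [m%n+o]%n≡[m+o]%n (x₀ + y * m) (j * m) a ⟩
    (x₀ + y * m + j * m) % a        ≡⟨ cong (_% a) (+-assoc x₀ (y * m) (j * m)) ⟩
    (x₀ + (y * m + j * m)) % a      ≡⟨ cong (λ t → (x₀ + t) % a) (*-distribʳ-+ m y j) ⟨
    (x₀ + (y + j) * m) % a          ∎
    where open ≡-Reasoning

  localMin⇒<m : ∀ {x y} → IsLocalMin a b c ℓ x y → 0 < y → x < m
  localMin⇒<m {x} {y} (_ , _ , _ , down) 0<y with x <? m
  ... | yes x<m = x<m
  ... | no x≮m = contradiction (down 0<y) (<⇒≱ downhill)
    where
    a≤x+ℓ : a ≤ x + ℓ
    a≤x+ℓ = subst (_≤ x + ℓ) (m∸n+n≡m (<⇒≤ ℓ<a)) (+-monoˡ-≤ ℓ (≮⇒≥ x≮m))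
    wrapped : (x + ℓ) % a < x
    wrapped = begin-strict
      (x + ℓ) % a      ≡⟨ m≤n⇒[n∸m]%m≡n%m a≤x+ℓ ⟨
      (x + ℓ ∸ a) % a  ≤⟨ m%n≤m (x + ℓ ∸ a) a ⟩
      x + ℓ ∸ a        <⟨ ∸-monoˡ-< (+-monoʳ-< x ℓ<a) a≤x+ℓ ⟩
      x + a ∸ a        ≡⟨ m+n∸n≡m x a ⟩
      x                ∎
      where open ≤-Reasoning
    downhill : v b c ((x + ℓ) % a) (y ∸ 1) < v b c x y
    downhill = +-mono-<-≤ (*-monoʳ-< b wrapped) (*-monoʳ-≤ c (m∸n≤m y 1))

  <ℓ⇒localMin : c ≤ b * ℓ → ∀ {x y} → x < ℓ → x < m → y < a → IsLocalMin a b c ℓ x y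
  <ℓ⇒localMin c≤bℓ {x} {y} x<ℓ x<m y<a = <-≤-trans x<m m≤a , y<a , (λ _ → up) , down y
    where
    x+ℓ<a : x + ℓ < a
    x+ℓ<a = subst (x + ℓ <_) (m∸n+n≡m (<⇒≤ ℓ<a)) (+-monoˡ-< ℓ x<m)
    x≤[x-ℓ]mod : x ≤ (ℤ.+ x ℤ.- ℤ.+ ℓ) mod a
    x≤[x-ℓ]mod = subst (x ≤_) (sym (m<n⇒[m-n]mod≡o∸[n∸m] a x<ℓ ℓ<a))
                   (m+n≤o⇒m≤o∸n x (subst (_≤ a) (sym (m+[n∸m]≡n (<⇒≤ x<ℓ))) (<⇒≤ ℓ<a)))
    up : v b c x y ≤ v b c ((ℤ.+ x ℤ.- ℤ.+ ℓ) mod a) (suc y)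
    up = v-mono-up b c y x≤[x-ℓ]mod
    down : ∀ y → 0 < y → v b c x y ≤ v b c ((x + ℓ) % a) (y ∸ 1)
    down (suc y) _ = subst (λ t → v b c x (suc y) ≤ v b c t y) (sym (m<n⇒m%n≡m x+ℓ<a))
                       (v-mono-down b c x ℓ y c≤bℓ)

  -- x + J m ≡ x_T + a with x_T < m says that J is the first step at which the sequence
  -- wraps around mod a.
  consecutive-at-first-wrap : c ≤ b * ℓ → ∀ {x y x' y'} → Consecutive a b c ℓ x y x' y' →
    ∀ J xT → 0 < J → xT < m → x + J * m ≡ xT + a →
    (y' ≡ y + J × x' ≡ xT) ⊎ (y + J < y' × ℓ ≤ xT)
  consecutive-at-first-wrap c≤bℓ {x} {y} {x'} {y'}
    (x₀ , _ , onX , onX' , _ , min' , y<y' , noneBetween) J xT 0<J xT<m wrap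
    = conclude (m≤n⇒m<n∨m≡n J≤j)
    where
    j : ℕ
    j = y' ∸ y

    y'≡y+j : y' ≡ y + j
    y'≡y+j = sym (m+[n∸m]≡n (<⇒≤ y<y'))

    x'≡ : ∀ i → y' ≡ y + i → x' ≡ (x + i * m) % a
    x'≡ i y'≡y+i = trans onX' (trans (cong (λ t → (x₀ + t * m) % a) y'≡y+i)
                                     (sym (onSeq-shift x₀ y onX i)))

    xT≡ : (x + J * m) % a ≡ xT
    xT≡ = trans (cong (_% a) wrap)
            (trans ([m+n]%n≡m%n xT a) (m<n⇒m%n≡m (<-≤-trans xT<m m≤a)))

    before-wrap : ∀ i → i < J → x + i * m < a
    before-wrap i i<J = +-cancelˡ-< m (x + i * m) a (begin-strict
      m + (x + i * m)  ≡⟨ +-assoc m x (i * m) ⟨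
      m + x + i * m    ≡⟨ cong (_+ i * m) (+-comm m x) ⟩
      x + m + i * m    ≡⟨ +-assoc x m (i * m) ⟩
      x + suc i * m    ≤⟨ +-monoʳ-≤ x (*-monoˡ-≤ m i<J) ⟩
      x + J * m        ≡⟨ wrap ⟩
      xT + a           <⟨ +-monoˡ-< a xT<m ⟩
      m + a            ∎)
      where open ≤-Reasoning

    J≤j : J ≤ j
    J≤j with J ≤? j
    ... | yes J≤j = J≤j
    ... | no J≰j = contradiction (localMin⇒<m min' (<-≤-trans z<s y<y')) (≤⇒≯ m≤x')
      where
      open ≤-Reasoning
      m≤x' : m ≤ x'
      m≤x' = begin
        m                ≤⟨ m≤n*m m j {{>-nonZero (m<n⇒0<n∸m y<y')}} ⟩
        j * m            ≤⟨ m≤n+m (j * m) x ⟩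
        x + j * m        ≡⟨ m<n⇒m%n≡m (before-wrap j (≰⇒> J≰j)) ⟨
        (x + j * m) % a  ≡⟨ x'≡ j y'≡y+j ⟨
        x'               ∎

    y+J<y' : J < j → y + J < y'
    y+J<y' J<j = subst (y + J <_) (sym y'≡y+j) (+-monoʳ-< y J<j)

    conclude : J < j ⊎ J ≡ j → (y' ≡ y + J × x' ≡ xT) ⊎ (y + J < y' × ℓ ≤ xT)
    conclude (inj₂ J≡j) = inj₁ (trans y'≡y+j (cong (y +_) (sym J≡j)) , x'≡xT)
      where
      x'≡xT : x' ≡ xT
      x'≡xT = trans (x'≡ J (trans y'≡y+j (cong (y +_) (sym J≡j)))) xT≡
    conclude (inj₁ J<j) with ℓ ≤? xT
    ... | yes ℓ≤xT = inj₂ (y+J<y' J<j , ℓ≤xT)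
    ... | no ℓ≰xT =
      contradiction (xT , y + J , onXT , minXT , m<m+n y 0<J , y+J<y' J<j) noneBetween
      where
      onXT : OnSeq a ℓ x₀ xT (y + J)
      onXT = subst (λ t → OnSeq a ℓ x₀ t (y + J)) xT≡ (onSeq-shift x₀ y onX J)
      minXT : IsLocalMin a b c ℓ xT (y + J)
      minXT = <ℓ⇒localMin c≤bℓ (≰⇒> ℓ≰xT) xT<m (<-trans (y+J<y' J<j) (proj₁ (proj₂ min')))

  consecutive-gap : c ≤ b * ℓ → ∀ {x y x' y'} → Consecutive a b c ℓ x y x' y' → x < m →
    ((x < r × y' ≡ y + (q + 1) × x' ≡ x + (m ∸ r))
      ⊎ (r ≤ x × y' ≡ y + q × x' + r ≡ x))
    ⊎ ((x < r × y' > y + (q + 1) × q ≡ 1 × r ≡ ℓ)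
      ⊎ (r ≤ x × y' > y + q × q ≡ 1 × r ≡ ℓ))
  consecutive-gap c≤bℓ {x} {y} {x'} {y'} consecutive x<m with x <? r
  ... | yes x<r = map (λ (y'≡ , x'≡) → inj₁ (x<r , y'≡ , x'≡))
                      (λ (y'> , ℓ≤xT) → inj₁ (x<r , y'> , ℓ<m⇒q≡1×r≡ℓ (≤-<-trans ℓ≤xT xT<m)))
                      (consecutive-at-first-wrap c≤bℓ consecutive (q + 1) xT (m≤n+m 1 q) xT<m wrap)
    where
    xT : ℕ
    xT = x + (m ∸ r)
    xT<m : xT < m
    xT<m = subst (xT <_) (m+[n∸m]≡n (<⇒≤ r<m)) (+-monoˡ-< (m ∸ r) x<r)
    wrap : x + (q + 1) * m ≡ xT + a
    wrap = begin
      x + (q + 1) * m              ≡⟨ cong (λ t → x + t * m) (+-comm q 1) ⟩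
      x + (m + q * m)              ≡⟨ cong (λ t → x + (t + q * m)) (m∸n+n≡m (<⇒≤ r<m)) ⟨
      x + ((m ∸ r) + r + q * m)    ≡⟨ cong (x +_) (+-assoc (m ∸ r) r (q * m)) ⟩
      x + ((m ∸ r) + (r + q * m))  ≡⟨ +-assoc x (m ∸ r) (r + q * m) ⟨
      xT + (r + q * m)             ≡⟨ cong (xT +_) a≡r+q*m ⟨
      xT + a                       ∎
      where open ≡-Reasoning
  ... | no x≮r = map (λ (y'≡ , x'≡) → inj₂ (r≤x , y'≡ , trans (cong (_+ r) x'≡) (m∸n+n≡m r≤x)))
                     (λ (y'> , ℓ≤xT) → inj₂ (r≤x , y'> , ℓ<m⇒q≡1×r≡ℓ (≤-<-trans ℓ≤xT xT<m)))
                     (consecutive-at-first-wrap c≤bℓ consecutive q xT q>0 xT<m wrap)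
    where
    r≤x : r ≤ x
    r≤x = ≮⇒≥ x≮r
    xT : ℕ
    xT = x ∸ r
    xT<m : xT < m
    xT<m = ≤-<-trans (m∸n≤m x r) x<m
    wrap : x + q * m ≡ xT + a
    wrap = begin
      x + q * m         ≡⟨ cong (_+ q * m) (m∸n+n≡m r≤x) ⟨
      xT + r + q * m    ≡⟨ +-assoc xT r (q * m) ⟩
      xT + (r + q * m)  ≡⟨ cong (xT +_) a≡r+q*m ⟨
      xT + a            ∎
      where open ≡-Reasoning

mainTheorem6 :
  (a b c ℓ b⁻¹ : ℕ) → .{{_ : NonZero a}} → .{{_ : NonZero b}} → .{{_ : NonZero (a ∸ ℓ)}} →
  2 ≤ a → a < b → b < c →
  Coprime a b → Coprime a c → Coprime b c →
  (b * b⁻¹) % a ≡ 1 →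
  ℓ < a → ℓ % a ≡ (c * b⁻¹) % a →
  let k = c / b
      q = a / (a ∸ ℓ)
      r = a ∸ q * (a ∸ ℓ)
  in ℓ > k → b * r > c * q →
  (x y x' y' : ℕ) → Consecutive a b c ℓ x y x' y' →
  x < a ∸ ℓ →
  ((x < r × y' ≡ y + (q + 1) × x' ≡ x + ((a ∸ ℓ) ∸ r))
    ⊎ (r ≤ x × y' ≡ y + q × x' + r ≡ x))
  ⊎ ((x < r × y' > y + (q + 1) × q ≡ 1 × r ≡ ℓ)
    ⊎ (r ≤ x × y' > y + q × q ≡ 1 × r ≡ ℓ))
mainTheorem6 a b c ℓ _ _ _ _ _ _ _ _ ℓ<a _ k<ℓ _ _ _ _ _ consecutive x<a∸ℓ =
  consecutive-gap c≤bℓ consecutive x<a∸ℓ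
  where
  open LocalMinima a b c ℓ ℓ<a
  c≤bℓ : c ≤ b * ℓ
  c≤bℓ = ≤-trans (<⇒≤ (m/n<o⇒m<o*n k<ℓ)) (≤-reflexive (*-comm ℓ b))
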